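{- Let $f\colon T\to V$ be a contraction between preorders. Then its posetification $\widetilde f\colon\widetilde T\to\widetilde V$, $[t]\mapsto[f(t)]$, is a contraction of posets.
   Context: For a preorder $T$, its posetification $\widetilde T$ is the poset of equivalence classes $[t]$ under $x\simeq y\iff(x\le y\text{ and }y\le x)$, with the induced order. In a preorder or poset write $a\lessdot a'$ ($a'$ covers $a$) if $a<a'$ (i.e. $a\le a'$ and not $a'\le a$) and there is no $x$ with $a<x<a'$. A monotone map of preorders $f\colon T\to V$ is a contraction (of preorders) if (1) it is the identity on objects; (2) for each $x\in V$, the preimage $f^{ -1}(x^{\simeq})$ is a connected sub-preorder of $T$, where $x^{\simeq}$ is the set of objects of $V$ equivalent to $x$; (3) for any cover $a\lessdot a'$ in $V$ there is a cover $t\lessdot t'$ in $T$ with $f(t)=a$, $f(t')=a'$. A map of posets $g\colon P\to Q$ is a contraction (of posets) if it is a monotone surjection, each fibre $g^{ -1}(q)$ is a connected convex subposet of $P$ (convex: $x\le z\le y$ with $x,y$ in it implies $z$ in it), and every cover $q\lessdot q'$ in $Q$ lifts to a cover $p\lessdot p'$ in $P$ with $g(p)=q,g(p')=q'$. -}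

module Defs where

open import Level using (Level; _⊔_)
open import Data.Product using (Σ; ∃; _×_; _,_; proj₁; proj₂)
open import Relation.Nullary using (¬_)
open import Relation.Binary.Core using (Rel)
open import Relation.Binary.Bundles using (Poset)
open import Relation.Binary.Structures using (IsPreorder; IsPartialOrder)
open import Relation.Binary.PropositionalEquality using (_≡_)
open import Relation.Binary.Construct.Closure.Equivalence using (EqClosure)

module PreorderNotions {a ℓ : Level} {X : Set a} (_≤_ : Rel X ℓ) where

  _≃_ : Rel X ℓ
  x ≃ y = (x ≤ y) × (y ≤ x)

  _<_ : Rel X ℓ
  x < y = (x ≤ y) × ¬ (y ≤ x)

  _⋖_ : Rel X (a ⊔ ℓ)
  x ⋖ y = (x < y) × ¬ (Σ X λ z → (x < z) × (z < y))

  Restrict : (S : X → Set ℓ) → Rel X ℓ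
  Restrict S x y = S x × S y × (x ≤ y)

  Connected : (S : X → Set ℓ) → Set (a ⊔ ℓ)
  Connected S = ∀ x y → S x → S y → EqClosure (Restrict S) x y

-- Posetification of a preorder: the poset of ≃-classes, represented as the
-- setoid (X, ≃) with the induced order (Agda has no quotient types).
posetify : ∀ {a ℓ} {X : Set a} (_≤_ : Rel X ℓ) →
           IsPreorder _≡_ _≤_ → Poset a ℓ ℓ
posetify {X = X} _≤_ isP = record
  { Carrier = X
  ; _≈_ = PreorderNotions._≃_ _≤_
  ; _≤_ = _≤_
  ; isPartialOrder = record
    { isPreorder = record
      { isEquivalence = record
        { refl = refl′ , refl′
        ; sym = λ { (p , q) → q , p }
        ; trans = λ { (p , q) (r , s) → trans p r , trans s q }
        }
      ; reflexive = proj₁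
      ; trans = trans
      }
    ; antisym = λ p q → p , q
    }
  }
  where
  open IsPreorder isP using (trans) renaming (refl to refl′)

-- Contraction of preorders T = (X, ≤T), V = (X, ≤V); the map f is the
-- identity on objects.
record IsPreorderContraction {a ℓ : Level} {X : Set a}
         (_≤T_ _≤V_ : Rel X ℓ) : Set (a ⊔ ℓ) where
  private
    module T = PreorderNotions _≤T_
    module V = PreorderNotions _≤V_
  field
    monotone  : ∀ {x y} → x ≤T y → x ≤V y
    connected : ∀ x → T.Connected (λ t → t V.≃ x)
    liftCover : ∀ {a a'} → a V.⋖ a' →
                Σ X λ t → Σ X λ t' → (t T.⋖ t') × (t ≡ a) × (t' ≡ a')

module PosetNotions {c ℓ₁ ℓ₂ : Level} (P : Poset c ℓ₁ ℓ₂) where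
  open Poset P

  _<_ : Rel Carrier (ℓ₁ ⊔ ℓ₂)
  x < y = (x ≤ y) × ¬ (x ≈ y)

  _⋖_ : Rel Carrier (c ⊔ ℓ₁ ⊔ ℓ₂)
  x ⋖ y = (x < y) × ¬ (Σ Carrier λ z → (x < z) × (z < y))

  Restrict : (S : Carrier → Set ℓ₁) → Rel Carrier (ℓ₁ ⊔ ℓ₂)
  Restrict S x y = S x × S y × (x ≤ y)

  Connected : (S : Carrier → Set ℓ₁) → Set (c ⊔ ℓ₁ ⊔ ℓ₂)
  Connected S = ∀ x y → S x → S y → EqClosure (Restrict S) x y

  Convex : (S : Carrier → Set ℓ₁) → Set (c ⊔ ℓ₁ ⊔ ℓ₂)
  Convex S = ∀ x y z → S x → S y → x ≤ z → z ≤ y → S z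

record IsPosetContraction {c ℓ₁ ℓ₂ : Level} (P Q : Poset c ℓ₁ ℓ₂)
         (g : Poset.Carrier P → Poset.Carrier Q) : Set (c ⊔ ℓ₁ ⊔ ℓ₂) where
  private
    module P = Poset P
    module Q = Poset Q
    module PN = PosetNotions P
    module QN = PosetNotions Q
  fibre : Q.Carrier → P.Carrier → Set ℓ₁
  fibre q p = g p Q.≈ q
  field
    wellDefined    : ∀ {x y} → x P.≈ y → g x Q.≈ g y
    monotone       : ∀ {x y} → x P.≤ y → g x Q.≤ g y
    surjective     : ∀ q → Σ P.Carrier λ p → g p Q.≈ q
    fibreConnected : ∀ q → PN.Connected (fibre q)
    fibreConvex    : ∀ q → PN.Convex (fibre q)
    liftCover      : ∀ {q q'} → q QN.⋖ q' →
                     Σ P.Carrier λ p → Σ P.Carrier λ p' →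
                       (p PN.⋖ p') × (g p Q.≈ q) × (g p' Q.≈ q')

{-# OPTIONS --safe #-}
-- Posetification keeps the carrier and the order and only coarsens equality to
-- ≃, so a strict inequality x ≤ y, x ≄ y of the poset is exactly a strict
-- inequality x ≤ y, y ≰ x of the preorder, and covers coincide as well.  Hence
-- cover lifting and connectedness of fibres carry over verbatim; surjectivity
-- is trivial, and the fibres (≃ᵥ-classes) are convex in T because ≤T ⊆ ≤V.
module Submission where

open import Defs
open import Level using (Level)
open import Function using (id)
open import Relation.Binary.Core using (Rel; _⇒_)
open import Relation.Binary.Structures using (IsPreorder)
open import Relation.Binary.PropositionalEquality using (_≡_; refl)
open import Data.Product using (Σ; _×_; _,_; proj₂)

module Posetification {a ℓ : Level} {X : Set a} (_≤_ : Rel X ℓ)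
                      (isPreorder : IsPreorder _≡_ _≤_) where

  open PreorderNotions _≤_
  open PosetNotions (posetify _≤_ isPreorder)
    renaming (_<_ to _<ᴾ_; _⋖_ to _⋖ᴾ_) using ()

  <⇒<ᴾ : ∀ {x y} → x < y → x <ᴾ y
  <⇒<ᴾ (x≤y , y≰x) = x≤y , λ x≃y → y≰x (proj₂ x≃y)

  <ᴾ⇒< : ∀ {x y} → x <ᴾ y → x < y
  <ᴾ⇒< (x≤y , x≄y) = x≤y , λ y≤x → x≄y (x≤y , y≤x)

  ⋖⇒⋖ᴾ : ∀ {x y} → x ⋖ y → x ⋖ᴾ y
  ⋖⇒⋖ᴾ (x<y , no-mid) =
    <⇒<ᴾ x<y , λ { (z , x<z , z<y) → no-mid (z , <ᴾ⇒< x<z , <ᴾ⇒< z<y) }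

  ⋖ᴾ⇒⋖ : ∀ {x y} → x ⋖ᴾ y → x ⋖ y
  ⋖ᴾ⇒⋖ (x<y , no-mid) =
    <ᴾ⇒< x<y , λ { (z , x<z , z<y) → no-mid (z , <⇒<ᴾ x<z , <⇒<ᴾ z<y) }

≃-class-convex : ∀ {a ℓ : Level} {X : Set a} {_≤T_ _≤V_ : Rel X ℓ} →
                 IsPreorder _≡_ _≤V_ → _≤T_ ⇒ _≤V_ →
                 ∀ q {x y z} → PreorderNotions._≃_ _≤V_ x q →
                 PreorderNotions._≃_ _≤V_ y q → x ≤T z → z ≤T y →
                 PreorderNotions._≃_ _≤V_ z q
≃-class-convex isV T⊆V q (_ , q≤x) (y≤q , _) x≤z z≤y =
  trans (T⊆V z≤y) y≤q , trans q≤x (T⊆V x≤z)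
  where open IsPreorder isV using (trans)

lemma5p3 : ∀ {a ℓ : Level} {X : Set a} (_≤T_ _≤V_ : Rel X ℓ)
    (isT : IsPreorder _≡_ _≤T_) (isV : IsPreorder _≡_ _≤V_) →
    IsPreorderContraction _≤T_ _≤V_ →
    IsPosetContraction (posetify _≤T_ isT) (posetify _≤V_ isV) id
lemma5p3 {X = X} _≤T_ _≤V_ isT isV f = record
  { wellDefined    = λ { (x≤y , y≤x) → monotone x≤y , monotone y≤x }
  ; monotone       = monotone
  ; surjective     = λ q → q , ≃-refl
  ; fibreConnected = connected
  ; fibreConvex    = λ q x y z → ≃-class-convex isV monotone q
  ; liftCover      = liftCoverᴾ
  }
  where
  open IsPreorderContraction f
  module T = Posetification _≤T_ isT
  module V = Posetification _≤V_ isV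
  open IsPreorder isV using () renaming (refl to ≤V-refl)
  open PreorderNotions _≤V_ using (_≃_)
  module T̃ = PosetNotions (posetify _≤T_ isT)
  module Ṽ = PosetNotions (posetify _≤V_ isV)

  ≃-refl : ∀ {x} → x ≃ x
  ≃-refl = ≤V-refl , ≤V-refl

  liftCoverᴾ : ∀ {q q'} → q Ṽ.⋖ q' →
               Σ X λ p → Σ X λ p' → (p T̃.⋖ p') × (p ≃ q) × (p' ≃ q')
  liftCoverᴾ q⋖q' with liftCover (V.⋖ᴾ⇒⋖ q⋖q')
  ... | t , t' , t⋖t' , refl , refl = t , t' , T.⋖⇒⋖ᴾ t⋖t' , ≃-refl , ≃-refl
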